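{- Let $q$ be a prime power, let $\rho\in\mathbb F_{q^5}$ with $\mathrm{Tr}_{q^5/q}(\rho)\neq0$, and let $g:\mathbb F_{q^5}\to\mathbb F_{q^5}$ be $\mathbb F_q$-linear with $\ker g=\mathbb F_q$ and such that $\mathrm{Tr}_{q^5/q}\circ g$ is the zero map. Let $$S=\{(\theta,y):\theta\in\mathbb F_q,\ y\in\mathbb F_{q^5},\ \mathrm{Tr}_{q^5/q}(y)=0\},\qquad T=\{(\theta,y):\theta\in\mathbb F_q,\ y\in\mathbb F_{q^5},\ \mathrm{Tr}_{q^5/q}(y)+2\theta=0\}.$$ Then the maps $\alpha:\mathbb F_{q^5}\to S$, $x\mapsto(\mathrm{Tr}_{q^5/q}(\rho x),g(x))$ and $\beta:\mathbb F_{q^5}\to T$, $x\mapsto(\mathrm{Tr}_{q^5/q}(x),-x-x^{q^2})$ are well defined and bijective.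
   Context: $\mathrm{Tr}_{q^5/q}(x)=x+x^q+x^{q^2}+x^{q^3}+x^{q^4}$. -}

module Defs where

open import Level using (Level; _⊔_)
open import Data.Nat using (ℕ; zero; suc; _^_)
open import Data.Nat.Primality using (Prime)
open import Data.Fin using (Fin)
open import Data.Product using (Σ; ∃; _×_; _,_)
open import Relation.Nullary using (¬_)
open import Relation.Binary.PropositionalEquality using (_≡_)
open import Algebra.Bundles using (CommutativeRing)

IsPrimePower : ℕ → Set
IsPrimePower q = Σ ℕ λ p → Σ ℕ λ k → Prime p × q ≡ p ^ suc k

record Field (c ℓ : Level) : Set (Level.suc (c ⊔ ℓ)) where
  field
    commRing : CommutativeRing c ℓ
  open CommutativeRing commRing public
  field
    0≉1     : ¬ (0# ≈ 1#)
    inverse : ∀ x → ¬ (x ≈ 0#) → Σ Carrier λ y → x * y ≈ 1#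

module FieldOps {c ℓ : Level} (K : Field c ℓ) where
  open Field K

  pow : Carrier → ℕ → Carrier
  pow x zero    = 1#
  pow x (suc n) = x * pow x n

  HasCard : ℕ → Set (c ⊔ ℓ)
  HasCard n = Σ (Fin n → Carrier) λ e →
                ((i j : Fin n) → e i ≈ e j → i ≡ j) × (∀ x → ∃ λ i → e i ≈ x)

  -- membership in the subfield F_q = { x : x^q = x }
  InSub : ℕ → Carrier → Set ℓ
  InSub q x = pow x q ≈ x

  Tr : ℕ → Carrier → Carrier
  Tr q x = x + pow x q + pow x (q ^ 2) + pow x (q ^ 3) + pow x (q ^ 4)

{-# OPTIONS --safe #-}

-- Both maps are additive, so injectivity only needs a trivial kernel. For α, a kernel element z
-- lies in ker g = F_q, and then Tr(ρz) = z Tr(ρ) forces z = 0. For β, z^{q²} = -z gives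
-- z^{q⁴} = z, hence z^q = z^{q⁵} = z; so z ∈ F_q, 2z = z + z^{q²} = 0 and 0 = Tr z = 5z = z.
-- Surjectivity needs no counting: for a suitable u the map (θ, y) ↦ θu + y is injective on the
-- target, since the trace recovers θ from θu + y (u = ρ for α, any u with Tr u ≠ 2 for β).
-- Composed with the injective map this is an injective, hence surjective, self-map of the
-- finite field. The trace identities used come from the additivity of x ↦ x^q (binomial
-- theorem in characteristic p) and from x^{q⁵} = x.

module Submission where

open import Defs
open import Level using (Level; _⊔_)
open import Algebra.Bundles using (CommutativeSemiring; Ring; CommutativeMonoid)
import Algebra.Properties.CommutativeMonoid.Sum as CommutativeMonoidSum
open import Data.Nat as ℕ using (ℕ; zero; suc; _!; _∸_; _<_; s≤s; z≤n; NonZero)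
import Data.Nat.Properties as ℕ
open import Data.Nat.Combinatorics using (_C_; k![n∸k]!∣n!; nCn≡1)
open import Data.Nat.Combinatorics.Specification using (nCk≡n!/k![n-k]!)
open import Data.Nat.DivMod using (m/n*n≡m)
open import Data.Nat.Divisibility using (_∣_; _∤_; divides; ∣⇒≤; m∣m*n; ∣1⇒≡1)
open import Data.Nat.Primality using (Prime; euclidsLemma; ¬prime[1])
open import Data.Fin as Fin using (Fin; punchOut; punchIn; toℕ; inject₁; fromℕ)
open import Data.Fin.Properties
  using (any?; punchOut-injective; punchInᵢ≢i; injective⇒≤; inject₁ℕ<; toℕ-fromℕ)
open import Data.Fin.Permutation using (Permutation; permutation)
open import Data.Product using (∃; _×_; _,_; proj₁; proj₂)
open import Data.Sum using (inj₁; inj₂)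
open import Function.Base using (id; _∘_)
open import Function.Definitions using (Injective)
open import Relation.Binary.Definitions using (Decidable)
open import Relation.Binary.PropositionalEquality as ≡ using (_≡_; _≢_)
open import Relation.Nullary using (¬_; yes; no; contradiction)
open import Relation.Nullary.Decidable using (map′)

Fin-injective⇒surjective : ∀ {n} (f : Fin n → Fin n) → Injective _≡_ _≡_ f →
                            ∀ j → ∃ λ i → f i ≡ j
Fin-injective⇒surjective {suc n} f f-inj j with any? (λ i → f i Fin.≟ j)
... | yes hit = hit
... | no miss = contradiction (injective⇒≤ avoid-j-injective) (ℕ.<-irrefl ≡.refl)
  where
  f≢j : ∀ i → j ≢ f i
  f≢j i j≡fi = miss (i , ≡.sym j≡fi)
  avoid-j : Fin (suc n) → Fin n
  avoid-j i = punchOut (f≢j i)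
  avoid-j-injective : Injective _≡_ _≡_ avoid-j
  avoid-j-injective eq = f-inj (punchOut-injective (f≢j _) (f≢j _) eq)

prime∤! : ∀ {p} → Prime p → ∀ {m} → m < p → p ∤ m !
prime∤! pr {zero} _ p∣1 = ¬prime[1] (≡.subst Prime (∣1⇒≡1 p∣1) pr)
prime∤! pr {suc m} m<p p∣m! with euclidsLemma (suc m) (m !) pr p∣m!
... | inj₁ p∣m+1 = ℕ.<-irrefl ≡.refl (ℕ.<-≤-trans m<p (∣⇒≤ p∣m+1))
... | inj₂ p∣m!  = prime∤! pr (ℕ.<-trans (ℕ.n<1+n m) m<p) p∣m!

prime∣! : ∀ {p} → Prime p → p ∣ p !
prime∣! {suc p} _ = m∣m*n (p !)

prime∣binomial : ∀ {p k} → Prime p → 0 < k → k < p → p ∣ p C k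
prime∣binomial {p} {k} pr 0<k k<p
  with euclidsLemma (p C k) (k ! ℕ.* (p ∸ k) !) pr p∣C*k![p∸k]!
  where
  instance
    k![p∸k]!≢0 : NonZero (k ! ℕ.* (p ∸ k) !)
    k![p∸k]!≢0 = k ℕ.!* (p ∸ k) !≢0
  C*k![p∸k]!≡p! : (p C k) ℕ.* (k ! ℕ.* (p ∸ k) !) ≡ p !
  C*k![p∸k]!≡p! = ≡.trans (≡.cong (ℕ._* (k ! ℕ.* (p ∸ k) !)) (nCk≡n!/k![n-k]! (ℕ.<⇒≤ k<p)))
                          (m/n*n≡m (k![n∸k]!∣n! (ℕ.<⇒≤ k<p)))
  p∣C*k![p∸k]! : p ∣ (p C k) ℕ.* (k ! ℕ.* (p ∸ k) !)
  p∣C*k![p∸k]! = ≡.subst (p ∣_) (≡.sym C*k![p∸k]!≡p!) (prime∣! pr)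
... | inj₁ p∣C = p∣C
... | inj₂ p∣k![p∸k]! with euclidsLemma (k !) ((p ∸ k) !) pr p∣k![p∸k]!
...   | inj₁ p∣k! = contradiction p∣k! (prime∤! pr k<p)
...   | inj₂ p∣[p∸k]! = contradiction p∣[p∸k]! (prime∤! pr (ℕ.∸-monoʳ-< 0<k (ℕ.<⇒≤ k<p)))

module Frobenius {c ℓ} (S : CommutativeSemiring c ℓ) where
  open CommutativeSemiring S hiding (zero)
  open import Algebra.Properties.Semiring.Mult semiring using (×-assoc-*) renaming (_×_ to _·_)
  open import Algebra.Properties.Monoid.Mult +-monoid using (×-congʳ; ×-assocˡ; ×-homo-1)
  open import Algebra.Properties.Semiring.Exp semiring using (_^_; ^-assocʳ; ^-congˡ)
  open import Algebra.Properties.CommutativeSemiring.Binomial S using (theorem; binomialTerm)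
  open import Algebra.Properties.Monoid.Sum +-monoid
    using (sum; sum-init-last; sum-cong-≋; sum-replicate-zero)
  open import Relation.Binary.Reasoning.Setoid setoid

  characteristic·≈0 : ∀ {p} → p · 1# ≈ 0# → ∀ x → p · x ≈ 0#
  characteristic·≈0 {p} p·1≈0 x = begin
    p · x          ≈⟨ ×-congʳ p (*-identityˡ x) ⟨
    p · (1# * x)   ≈⟨ ×-assoc-* p 1# x ⟨
    (p · 1#) * x   ≈⟨ *-congʳ p·1≈0 ⟩
    0# * x         ≈⟨ zeroˡ x ⟩
    0#             ∎

  binomial·≈0 : ∀ {p k} → Prime p → p · 1# ≈ 0# → 0 < k → k < p → ∀ x → (p C k) · x ≈ 0#
  binomial·≈0 {p} {k} p-prime p·1≈0 0<k k<p x with prime∣binomial p-prime 0<k k<p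
  ... | divides r pCk≡r*p = begin
    (p C k) · x    ≡⟨ ≡.cong (_· x) (≡.trans pCk≡r*p (ℕ.*-comm r p)) ⟩
    (p ℕ.* r) · x  ≈⟨ ×-assocˡ x p r ⟨
    p · (r · x)    ≈⟨ characteristic·≈0 {p} p·1≈0 (r · x) ⟩
    0#             ∎

  binomial-without-middle : ∀ n x y → (∀ i → binomialTerm x y (suc n) (Fin.suc (inject₁ i)) ≈ 0#) →
                            (x + y) ^ suc n ≈ x ^ suc n + y ^ suc n
  binomial-without-middle n x y middle≈0 = begin
    (x + y) ^ suc n                                               ≈⟨ theorem (suc n) x y ⟩
    t Fin.zero + sum (t ∘ Fin.suc)                                ≈⟨ +-congˡ (sum-init-last (t ∘ Fin.suc)) ⟩
    t Fin.zero + (sum (t ∘ Fin.suc ∘ inject₁) + t (fromℕ (suc n))) ≈⟨ +-cong first (+-cong middle last) ⟩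
    y ^ suc n + (0# + x ^ suc n)                                  ≈⟨ +-congˡ (+-identityˡ _) ⟩
    y ^ suc n + x ^ suc n                                         ≈⟨ +-comm _ _ ⟩
    x ^ suc n + y ^ suc n                                         ∎
    where
    t : Fin (suc (suc n)) → Carrier
    t = binomialTerm x y (suc n)
    first : t Fin.zero ≈ y ^ suc n
    first = trans (+-identityʳ _) (*-identityˡ _)
    middle : sum (t ∘ Fin.suc ∘ inject₁) ≈ 0#
    middle = trans (sum-cong-≋ middle≈0) (sum-replicate-zero n)
    last : t (fromℕ (suc n)) ≈ x ^ suc n
    last = begin
      (suc n C toℕ (fromℕ (suc n))) · (x ^ toℕ (fromℕ (suc n)) * y ^ (suc n ∸ toℕ (fromℕ (suc n))))
        ≡⟨ ≡.cong (λ k → (suc n C k) · (x ^ k * y ^ (suc n ∸ k))) (toℕ-fromℕ (suc n)) ⟩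
      (suc n C suc n) · (x ^ suc n * y ^ (suc n ∸ suc n))
        ≡⟨ ≡.cong₂ (λ c k → c · (x ^ suc n * y ^ k)) (nCn≡1 (suc n)) (ℕ.n∸n≡0 (suc n)) ⟩
      1 · (x ^ suc n * 1#)                                       ≈⟨ ×-homo-1 _ ⟩
      x ^ suc n * 1#                                             ≈⟨ *-identityʳ _ ⟩
      x ^ suc n                                                  ∎

  frobenius : ∀ {p} → Prime p → p · 1# ≈ 0# → ∀ x y → (x + y) ^ p ≈ x ^ p + y ^ p
  frobenius {suc n} p-prime p·1≈0 x y = binomial-without-middle n x y λ i →
    binomial·≈0 {k = suc (toℕ (inject₁ i))} p-prime p·1≈0 (s≤s z≤n) (s≤s (inject₁ℕ< i)) _

  frobenius^ : ∀ {p} → Prime p → p · 1# ≈ 0# →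
               ∀ j x y → (x + y) ^ (p ℕ.^ j) ≈ x ^ (p ℕ.^ j) + y ^ (p ℕ.^ j)
  frobenius^ p-prime p·1≈0 zero x y = distribʳ 1# x y
  frobenius^ {p} p-prime p·1≈0 (suc j) x y = begin
    (x + y) ^ (p ℕ.* p ℕ.^ j)               ≈⟨ ^-assocʳ (x + y) p (p ℕ.^ j) ⟨
    ((x + y) ^ p) ^ (p ℕ.^ j)               ≈⟨ ^-congˡ (p ℕ.^ j) (frobenius p-prime p·1≈0 x y) ⟩
    (x ^ p + y ^ p) ^ (p ℕ.^ j)             ≈⟨ frobenius^ p-prime p·1≈0 j (x ^ p) (y ^ p) ⟩
    (x ^ p) ^ (p ℕ.^ j) + (y ^ p) ^ (p ℕ.^ j) ≈⟨ +-cong (^-assocʳ x p (p ℕ.^ j)) (^-assocʳ y p (p ℕ.^ j)) ⟩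
    x ^ (p ℕ.* p ℕ.^ j) + y ^ (p ℕ.* p ℕ.^ j) ∎

module AdditiveMaps {c ℓ} (R : Ring c ℓ) where
  open Ring R
  open import Algebra.Properties.Ring R
    using (x+x≈x⇒x≈0; +-inverseʳ-unique; -‿+-comm; x∙y⁻¹≈ε⇒x≈y; x≈y⇒x∙y⁻¹≈ε)
  open import Algebra.Properties.CommutativeSemigroup +-commutativeSemigroup using (interchange)

  record IsAdditive (f : Carrier → Carrier) : Set (c ⊔ ℓ) where
    field
      cong   : ∀ {x y} → x ≈ y → f x ≈ f y
      +-homo : ∀ x y → f (x + y) ≈ f x + f y

    0-homo : f 0# ≈ 0#
    0-homo = x+x≈x⇒x≈0 (f 0#) (trans (sym (+-homo 0# 0#)) (cong (+-identityʳ 0#)))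

    -‿homo : ∀ x → f (- x) ≈ - f x
    -‿homo x = +-inverseʳ-unique (f x) (f (- x))
                 (trans (sym (+-homo x (- x))) (trans (cong (-‿inverseʳ x)) 0-homo))

    sub-homo : ∀ x y → f (x - y) ≈ f x - f y
    sub-homo x y = trans (+-homo x (- y)) (+-congˡ (-‿homo y))

  open IsAdditive

  infixl 6 _⊕_
  _⊕_ : (Carrier → Carrier) → (Carrier → Carrier) → Carrier → Carrier
  (f ⊕ g) x = f x + g x

  Commute : (Carrier → Carrier) → (Carrier → Carrier) → Set (c ⊔ ℓ)
  Commute φ f = ∀ x → φ (f x) ≈ f (φ x)

  id-additive : IsAdditive id
  id-additive = record { cong = id ; +-homo = λ _ _ → refl }

  -‿additive : IsAdditive (-_)
  -‿additive = record { cong = -‿cong ; +-homo = λ x y → sym (-‿+-comm x y) }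

  *-additive : ∀ a → IsAdditive (a *_)
  *-additive a = record { cong = *-congˡ ; +-homo = distribˡ a }

  ∘-additive : ∀ {f g} → IsAdditive f → IsAdditive g → IsAdditive (f ∘ g)
  ∘-additive f-add g-add = record
    { cong   = cong f-add ∘ cong g-add
    ; +-homo = λ x y → trans (cong f-add (+-homo g-add x y)) (+-homo f-add _ _)
    }

  ⊕-additive : ∀ {f g} → IsAdditive f → IsAdditive g → IsAdditive (f ⊕ g)
  ⊕-additive f-add g-add = record
    { cong   = λ x≈y → +-cong (cong f-add x≈y) (cong g-add x≈y)
    ; +-homo = λ x y → trans (+-cong (+-homo f-add x y) (+-homo g-add x y)) (interchange _ _ _ _)
    }

  ⊕-commute : ∀ {φ f g} → IsAdditive φ → Commute φ f → Commute φ g → Commute φ (f ⊕ g)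
  ⊕-commute φ-add φf≈fφ φg≈gφ x = trans (+-homo φ-add _ _) (+-cong (φf≈fφ x) (φg≈gφ x))

  kernel-trivial⇒injective₂ : ∀ {f g} → IsAdditive f → IsAdditive g →
                              (∀ z → f z ≈ 0# → g z ≈ 0# → z ≈ 0#) →
                              ∀ x y → f x ≈ f y → g x ≈ g y → x ≈ y
  kernel-trivial⇒injective₂ f-add g-add kernel-trivial x y fx≈fy gx≈gy =
    x∙y⁻¹≈ε⇒x≈y x y (kernel-trivial (x - y) (vanishes f-add fx≈fy) (vanishes g-add gx≈gy))
    where
    vanishes : ∀ {h} → IsAdditive h → h x ≈ h y → h (x - y) ≈ 0#
    vanishes h-add hx≈hy = trans (sub-homo h-add x y) (x≈y⇒x∙y⁻¹≈ε hx≈hy)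

module _ {c ℓ} (M : CommutativeMonoid c ℓ) where
  open CommutativeMonoid M
  open import Algebra.Properties.CommutativeMonoid.Sum M using (sum; sum-remove; sum-cong-≋)
  open import Algebra.Properties.CommutativeSemigroup commutativeSemigroup using (x∙yz≈y∙xz)

  sum-swap-at : ∀ {n} (s t : Fin n → Carrier) (z : Fin n) → (∀ i → i ≢ z → s i ≈ t i) →
                t z ∙ sum s ≈ s z ∙ sum t
  sum-swap-at {suc n} s t z s≈t = begin
    t z ∙ sum s                         ≈⟨ ∙-congˡ (sum-remove {i = z} s) ⟩
    t z ∙ (s z ∙ sum (s ∘ punchIn z))   ≈⟨ x∙yz≈y∙xz (t z) (s z) _ ⟩
    s z ∙ (t z ∙ sum (s ∘ punchIn z))   ≈⟨ ∙-congˡ (∙-congˡ (sum-cong-≋ (λ j → s≈t _ (punchInᵢ≢i z j)))) ⟩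
    s z ∙ (t z ∙ sum (t ∘ punchIn z))   ≈⟨ ∙-congˡ (sum-remove {i = z} t) ⟨
    s z ∙ sum t                         ∎
    where open import Relation.Binary.Reasoning.Setoid setoid

module _ {c ℓ} (K : Field c ℓ) where
  open Field K
  open FieldOps K
  open AdditiveMaps ring
  open IsAdditive
  open import Algebra.Properties.Ring ring
    using (+-cancelˡ; +-cancelʳ; +-identityʳ-unique; +-inverseʳ-unique; +-inverseˡ-unique;
           -‿involutive; -‿injective; -‿+-comm; -‿distribʳ-*; x∙y⁻¹≈ε⇒x≈y)
  open import Algebra.Properties.Semiring.Exp semiring using (_^_; ^-congˡ; ^-assocʳ)
  open import Algebra.Properties.CommutativeSemiring.Exp commutativeSemiring using (^-distrib-*)
  open import Algebra.Properties.Semiring.Mult semiring using (×1-homo-*) renaming (_×_ to _·_)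
  open import Relation.Binary.Reasoning.Setoid setoid

  pow≡^ : ∀ x n → pow x n ≡ x ^ n
  pow≡^ x zero    = ≡.refl
  pow≡^ x (suc n) = ≡.cong (x *_) (pow≡^ x n)

  pow-congˡ : ∀ n {x y} → x ≈ y → pow x n ≈ pow y n
  pow-congˡ n {x} {y} rewrite pow≡^ x n | pow≡^ y n = ^-congˡ n

  pow-assocʳ : ∀ x m n → pow (pow x m) n ≈ pow x (m ℕ.* n)
  pow-assocʳ x m n rewrite pow≡^ (pow x m) n | pow≡^ x m | pow≡^ x (m ℕ.* n) = ^-assocʳ x m n

  pow-distrib-* : ∀ x y n → pow (x * y) n ≈ pow x n * pow y n
  pow-distrib-* x y n rewrite pow≡^ (x * y) n | pow≡^ x n | pow≡^ y n = ^-distrib-* x y n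

  pow-1# : ∀ n → pow 1# n ≈ 1#
  pow-1# zero    = refl
  pow-1# (suc n) = trans (*-identityˡ _) (pow-1# n)

  *-cancelʳ-nonzero : ∀ {a} → ¬ a ≈ 0# → ∀ x y → x * a ≈ y * a → x ≈ y
  *-cancelʳ-nonzero {a} a≉0 x y xa≈ya = begin
    x                 ≈⟨ *-identityʳ x ⟨
    x * 1#            ≈⟨ *-congˡ a*a⁻¹≈1 ⟨
    x * (a * a⁻¹)     ≈⟨ *-assoc x a a⁻¹ ⟨
    (x * a) * a⁻¹     ≈⟨ *-congʳ xa≈ya ⟩
    (y * a) * a⁻¹     ≈⟨ *-assoc y a a⁻¹ ⟩
    y * (a * a⁻¹)     ≈⟨ *-congˡ a*a⁻¹≈1 ⟩
    y * 1#            ≈⟨ *-identityʳ y ⟩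
    y                 ∎
    where
    a⁻¹ : Carrier
    a⁻¹ = proj₁ (inverse a a≉0)
    a*a⁻¹≈1 : a * a⁻¹ ≈ 1#
    a*a⁻¹≈1 = proj₂ (inverse a a≉0)

  *-cancelˡ-nonzero : ∀ {a} → ¬ a ≈ 0# → ∀ x y → a * x ≈ a * y → x ≈ y
  *-cancelˡ-nonzero a≉0 x y ax≈ay =
    *-cancelʳ-nonzero a≉0 x y (trans (*-comm x _) (trans ax≈ay (*-comm _ y)))

  *-nonzero : ∀ {a b} → ¬ a ≈ 0# → ¬ b ≈ 0# → ¬ a * b ≈ 0#
  *-nonzero {a} {b} a≉0 b≉0 ab≈0 = b≉0 (*-cancelʳ-nonzero a≉0 b 0# (begin
    b * a    ≈⟨ *-comm b a ⟩
    a * b    ≈⟨ ab≈0 ⟩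
    0#       ≈⟨ zeroˡ a ⟨
    0# * a   ∎))

  ·1-homo-^ : ∀ n m → (n ℕ.^ m) · 1# ≈ (n · 1#) ^ m
  ·1-homo-^ n zero    = +-identityʳ 1#
  ·1-homo-^ n (suc m) = trans (×1-homo-* n (n ℕ.^ m)) (*-congˡ (·1-homo-^ n m))

  ^-nonzero : ∀ {a} → ¬ a ≈ 0# → ∀ n → ¬ a ^ n ≈ 0#
  ^-nonzero a≉0 zero    1≈0 = 0≉1 (sym 1≈0)
  ^-nonzero a≉0 (suc n) = *-nonzero a≉0 (^-nonzero a≉0 n)

  module FiniteField {N : ℕ} (card : HasCard N) where
    open CommutativeMonoidSum +-commutativeMonoid using (sum; ∑-distrib-+; sum-replicate)
    open CommutativeMonoidSum *-commutativeMonoid using ()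
      renaming (sum to ∏; ∑-distrib-+ to ∏-distrib-*; sum-replicate to ∏-replicate)

    element : Fin N → Carrier
    element = proj₁ card

    element-injective : ∀ i j → element i ≈ element j → i ≡ j
    element-injective = proj₁ (proj₂ card)

    index : Carrier → Fin N
    index x = proj₁ (proj₂ (proj₂ card) x)

    element-index : ∀ x → element (index x) ≈ x
    element-index x = proj₂ (proj₂ (proj₂ card) x)

    index-injective : ∀ {x y} → index x ≡ index y → x ≈ y
    index-injective {x} {y} eq =
      trans (sym (element-index x)) (trans (reflexive (≡.cong element eq)) (element-index y))

    index-cong : ∀ {x y} → x ≈ y → index x ≡ index y
    index-cong {x} {y} x≈y =
      element-injective _ _ (trans (element-index x) (trans x≈y (sym (element-index y))))

    infix 4 _≟_
    _≟_ : Decidable _≈_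
    x ≟ y = map′ index-injective index-cong (index x Fin.≟ index y)

    module _ (h : Carrier → Carrier) (h-injective : ∀ x y → h x ≈ h y → x ≈ y) where

      private
        h↾ : Fin N → Fin N
        h↾ i = index (h (element i))

        h↾-injective : Injective _≡_ _≡_ h↾
        h↾-injective eq = element-injective _ _ (h-injective _ _ (index-injective eq))

        h↾-surjective : ∀ j → ∃ λ i → h↾ i ≡ j
        h↾-surjective = Fin-injective⇒surjective h↾ h↾-injective

        π : Permutation N N
        π = permutation h↾ (proj₁ ∘ h↾-surjective) (proj₂ ∘ h↾-surjective)
                        (λ i → h↾-injective (proj₂ (h↾-surjective (h↾ i))))

      injective⇒surjective : ∀ z → ∃ λ x → h x ≈ z
      injective⇒surjective z with h↾-surjective (index z)
      ... | i , h↾i≡z = element i , index-injective h↾i≡z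

      module _ {m ℓm} (M : CommutativeMonoid m ℓm) where
        private
          module M = CommutativeMonoid M
          module ΣM = CommutativeMonoidSum M

        ∑-reindex : (f : Carrier → M.Carrier) → (∀ {x y} → x ≈ y → f x M.≈ f y) →
                    ΣM.sum (f ∘ h ∘ element) M.≈ ΣM.sum (f ∘ element)
        ∑-reindex f f-cong = M.sym (M.trans (ΣM.sum-permute (f ∘ element) π)
          (ΣM.sum-cong-≋ (λ i → f-cong (element-index (h (element i))))))

    N·1≈0 : N · 1# ≈ 0#
    N·1≈0 = +-identityʳ-unique (sum element) (N · 1#) (begin
      sum element + N · 1#                ≈⟨ +-congˡ (sum-replicate N) ⟨
      sum element + sum {N} (λ _ → 1#)    ≈⟨ ∑-distrib-+ element (λ _ → 1#) ⟨
      sum (λ i → element i + 1#)          ≈⟨ ∑-reindex (_+ 1#) +1-injective +-commutativeMonoid id id ⟩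
      sum element                         ∎)
      where
      +1-injective : ∀ x y → x + 1# ≈ y + 1# → x ≈ y
      +1-injective = +-cancelʳ 1#

    ^≈0⇒≈0 : ∀ {a} n → a ^ n ≈ 0# → a ≈ 0#
    ^≈0⇒≈0 {a} n aⁿ≈0 with a ≟ 0#
    ... | yes a≈0 = a≈0
    ... | no  a≉0 = contradiction aⁿ≈0 (^-nonzero a≉0 n)

    characteristic : ∀ {n m} → N ≡ n ℕ.^ m → n · 1# ≈ 0#
    characteristic {n} {m} N≡nᵐ = ^≈0⇒≈0 m (begin
      (n · 1#) ^ m     ≈⟨ ·1-homo-^ n m ⟨
      (n ℕ.^ m) · 1#   ≡⟨ ≡.cong (_· 1#) N≡nᵐ ⟨
      N · 1#           ≈⟨ N·1≈0 ⟩
      0#               ∎)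

    private
      unitPart : Carrier → Carrier
      unitPart a with a ≟ 0#
      ... | yes _ = 1#
      ... | no  _ = a

      unitPart-zero : ∀ {a} → a ≈ 0# → unitPart a ≈ 1#
      unitPart-zero {a} a≈0 with a ≟ 0#
      ... | yes _   = refl
      ... | no  a≉0 = contradiction a≈0 a≉0

      unitPart-unit : ∀ {a} → ¬ a ≈ 0# → unitPart a ≈ a
      unitPart-unit {a} a≉0 with a ≟ 0#
      ... | yes a≈0 = contradiction a≈0 a≉0
      ... | no  _   = refl

      unitPart-nonzero : ∀ a → ¬ unitPart a ≈ 0#
      unitPart-nonzero a with a ≟ 0#
      ... | yes _   = λ 1≈0 → 0≉1 (sym 1≈0)
      ... | no  a≉0 = a≉0

      unitPart-cong : ∀ {a b} → a ≈ b → unitPart a ≈ unitPart b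
      unitPart-cong {a} {b} a≈b with b ≟ 0#
      ... | yes b≈0 = unitPart-zero (trans a≈b b≈0)
      ... | no  b≉0 = trans (unitPart-unit (λ a≈0 → b≉0 (trans (sym a≈b) a≈0))) a≈b

      ∏-nonzero : ∀ {n} (t : Fin n → Carrier) → (∀ i → ¬ t i ≈ 0#) → ¬ ∏ t ≈ 0#
      ∏-nonzero {zero}  t t≉0 1≈0 = 0≉1 (sym 1≈0)
      ∏-nonzero {suc n} t t≉0 = *-nonzero (t≉0 Fin.zero) (∏-nonzero (t ∘ Fin.suc) (t≉0 ∘ Fin.suc))

      0^n≈0 : ∀ {n} → Fin n → 0# ^ n ≈ 0#
      0^n≈0 {suc n} _ = zeroˡ _

    -- Multiplication by x ≉ 0 permutes K, so it fixes the product A of all elements with 0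
    -- replaced by 1; as the factor at 0 stays 1 instead of becoming x, this says x ^ N * A ≈ x * A.
    fermat : ∀ x → x ^ N ≈ x
    fermat x with x ≟ 0#
    ... | yes x≈0 = trans (^-congˡ N x≈0) (trans (0^n≈0 (index 0#)) (sym x≈0))
    ... | no  x≉0 = *-cancelʳ-nonzero A≉0 (x ^ N) x (begin
      x ^ N * A          ≈⟨ *-congʳ (∏-replicate N) ⟨
      ∏ {N} (λ _ → x) * A ≈⟨ ∏-distrib-* (λ _ → x) u ⟨
      ∏ s                ≈⟨ *-identityˡ (∏ s) ⟨
      1# * ∏ s           ≈⟨ *-congʳ t[z]≈1 ⟨
      t z * ∏ s          ≈⟨ sum-swap-at *-commutativeMonoid s t z s≈t ⟩
      s z * ∏ t          ≈⟨ *-cong s[z]≈x ∏t≈A ⟩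
      x * A              ∎)
      where
      u s t : Fin N → Carrier
      u i = unitPart (element i)
      s i = x * u i
      t i = unitPart (x * element i)
      A : Carrier
      A = ∏ u
      A≉0 : ¬ A ≈ 0#
      A≉0 = ∏-nonzero u (unitPart-nonzero ∘ element)
      ∏t≈A : ∏ t ≈ A
      ∏t≈A = ∑-reindex (x *_) (*-cancelˡ-nonzero x≉0) *-commutativeMonoid unitPart unitPart-cong
      z : Fin N
      z = index 0#
      t[z]≈1 : t z ≈ 1#
      t[z]≈1 = unitPart-zero (trans (*-congˡ (element-index 0#)) (zeroʳ x))
      s[z]≈x : s z ≈ x
      s[z]≈x = trans (*-congˡ (unitPart-zero (element-index 0#))) (*-identityʳ x)
      s≈t : ∀ i → i ≢ z → s i ≈ t i
      s≈t i i≢z = trans (*-congˡ (unitPart-unit eᵢ≉0)) (sym (unitPart-unit (*-nonzero x≉0 eᵢ≉0)))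
        where
        eᵢ≉0 : ¬ element i ≈ 0#
        eᵢ≉0 eᵢ≈0 = i≢z (element-injective i z (trans eᵢ≈0 (sym (element-index 0#))))

    module _ {s} (S : Carrier → Carrier → Set s) (D : Carrier → Carrier) (u d : Carrier)
             (D-cong : ∀ {x y} → x ≈ y → D x ≈ D y) (d≉0 : ¬ d ≈ 0#)
             (D-decodes : ∀ {θ y} → S θ y → D (θ * u + y) ≈ θ * d) where

      encode-injective : ∀ {θ y θ′ y′} → S θ y → S θ′ y′ → θ * u + y ≈ θ′ * u + y′ → θ ≈ θ′ × y ≈ y′
      encode-injective {θ} {y} {θ′} {y′} Sθy Sθ′y′ eq = θ≈θ′ , y≈y′
        where
        θ≈θ′ : θ ≈ θ′
        θ≈θ′ = *-cancelʳ-nonzero d≉0 θ θ′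
                 (trans (sym (D-decodes Sθy)) (trans (D-cong eq) (D-decodes Sθ′y′)))
        y≈y′ : y ≈ y′
        y≈y′ = +-cancelˡ (θ * u) y y′ (trans eq (+-congʳ (*-congʳ (sym θ≈θ′))))

      injection⇒surjection : (A B : Carrier → Carrier) → (∀ x → S (A x) (B x)) →
                             (∀ x x′ → A x ≈ A x′ → B x ≈ B x′ → x ≈ x′) →
                             ∀ {θ y} → S θ y → ∃ λ x → A x ≈ θ × B x ≈ y
      injection⇒surjection A B S-AB AB-injective {θ} {y} Sθy
        with injective⇒surjective encode∘AB encode∘AB-injective (θ * u + y)
        where
        encode∘AB : Carrier → Carrier
        encode∘AB x = A x * u + B x
        encode∘AB-injective : ∀ x x′ → encode∘AB x ≈ encode∘AB x′ → x ≈ x′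
        encode∘AB-injective x x′ eq = let (Ax≈Ax′ , Bx≈Bx′) = encode-injective (S-AB x) (S-AB x′) eq
                                      in AB-injective x x′ Ax≈Ax′ Bx≈Bx′
      ... | x , encodes = x , encode-injective (S-AB x) Sθy encodes

  module Trace (q : ℕ) (frob-+ : ∀ x y → pow (x + y) q ≈ pow x q + pow y q)
               (frob^5≈id : ∀ x → pow x (q ℕ.^ 5) ≈ x) where

    frob : Carrier → Carrier
    frob x = pow x q

    frob^ : ℕ → Carrier → Carrier
    frob^ j x = pow x (q ℕ.^ j)

    frob^1≈frob : ∀ x → frob^ 1 x ≈ frob x
    frob^1≈frob x = reflexive (≡.cong (pow x) (ℕ.*-identityʳ q))

    frob^-suc : ∀ j x → frob^ (suc j) x ≈ frob^ j (frob x)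
    frob^-suc j x = sym (pow-assocʳ x q (q ℕ.^ j))

    frob^-frob^ : ∀ i j x → frob^ i (frob^ j x) ≈ frob^ (j ℕ.+ i) x
    frob^-frob^ i j x = trans (pow-assocʳ x (q ℕ.^ j) (q ℕ.^ i))
                              (reflexive (≡.cong (pow x) (≡.sym (ℕ.^-distribˡ-+-* q j i))))

    frob-additive : IsAdditive frob
    frob-additive = record { cong = pow-congˡ q ; +-homo = frob-+ }

    frob^-additive : ∀ j → IsAdditive (frob^ j)
    frob^-additive zero    = record { cong = pow-congˡ 1 ; +-homo = λ x y → distribʳ 1# x y }
    frob^-additive (suc j) = record
      { cong   = pow-congˡ (q ℕ.^ suc j)
      ; +-homo = λ x y → begin
          frob^ (suc j) (x + y)                   ≈⟨ frob^-suc j (x + y) ⟩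
          frob^ j (frob (x + y))                  ≈⟨ cong (frob^-additive j) (frob-+ x y) ⟩
          frob^ j (frob x + frob y)               ≈⟨ +-homo (frob^-additive j) (frob x) (frob y) ⟩
          frob^ j (frob x) + frob^ j (frob y)     ≈⟨ +-cong (frob^-suc j x) (frob^-suc j y) ⟨
          frob^ (suc j) x + frob^ (suc j) y       ∎
      }

    frob^-fixes-Fq : ∀ j {a} → InSub q a → frob^ j a ≈ a
    frob^-fixes-Fq zero    {a} _   = *-identityʳ a
    frob^-fixes-Fq (suc j) {a} a∈Fq =
      trans (frob^-suc j a) (trans (cong (frob^-additive j) a∈Fq) (frob^-fixes-Fq j a∈Fq))

    commute-frob^ : ∀ {φ} → IsAdditive φ → Commute φ frob → ∀ j → Commute φ (frob^ j)
    commute-frob^ φ-add φ-frob zero    x = trans (cong φ-add (*-identityʳ x)) (sym (*-identityʳ _))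
    commute-frob^ {φ} φ-add φ-frob (suc j) x = begin
      φ (frob^ (suc j) x)    ≈⟨ cong φ-add (frob^-suc j x) ⟩
      φ (frob^ j (frob x))   ≈⟨ commute-frob^ φ-add φ-frob j (frob x) ⟩
      frob^ j (φ (frob x))   ≈⟨ cong (frob^-additive j) (φ-frob x) ⟩
      frob^ j (frob (φ x))   ≈⟨ frob^-suc j (φ x) ⟨
      frob^ (suc j) (φ x)    ∎

    -- Tr q is definitionally id ⊕ frob ⊕ frob^ 2 ⊕ frob^ 3 ⊕ frob^ 4.
    commute-Tr : ∀ {φ} → IsAdditive φ → Commute φ frob → Commute φ (Tr q)
    commute-Tr {φ} φ-add φ-frob = ⊕-commute φ-add (⊕-commute φ-add (⊕-commute φ-add
      (⊕-commute φ-add (λ _ → refl) φ-frob) (φ-frob^ 2)) (φ-frob^ 3)) (φ-frob^ 4)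
      where
      φ-frob^ : ∀ j → Commute φ (frob^ j)
      φ-frob^ = commute-frob^ φ-add φ-frob

    Tr-additive : IsAdditive (Tr q)
    Tr-additive = ⊕-additive (⊕-additive (⊕-additive (⊕-additive id-additive frob-additive)
      (frob^-additive 2)) (frob^-additive 3)) (frob^-additive 4)

    Tr-scalar : ∀ {a} → InSub q a → ∀ x → a * Tr q x ≈ Tr q (a * x)
    Tr-scalar {a} a∈Fq = commute-Tr (*-additive a) λ x → sym (begin
      frob (a * x)       ≈⟨ pow-distrib-* a x q ⟩
      frob a * frob x    ≈⟨ *-congʳ a∈Fq ⟩
      a * frob x         ∎)

    frob²≈frob^2 : ∀ x → frob (frob x) ≈ frob^ 2 x
    frob²≈frob^2 x = sym (trans (frob^-suc 1 x) (frob^1≈frob (frob x)))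

    Tr-frob : ∀ x → Tr q (frob x) ≈ Tr q x
    Tr-frob x = begin
      frob x + frob (frob x) + frob^ 2 (frob x) + frob^ 3 (frob x) + frob^ 4 (frob x)
        ≈⟨ +-cong (+-cong (+-cong (+-congˡ (frob²≈frob^2 x)) (sym (frob^-suc 2 x))) (sym (frob^-suc 3 x)))
                  (trans (sym (frob^-suc 4 x)) (frob^5≈id x)) ⟩
      frob x + frob^ 2 x + frob^ 3 x + frob^ 4 x + x     ≈⟨ rotate _ _ _ _ _ ⟩
      x + frob x + frob^ 2 x + frob^ 3 x + frob^ 4 x     ∎
      where
      rotate : ∀ a b c d e → a + b + c + d + e ≈ e + a + b + c + d
      rotate a b c d e = begin
        a + b + c + d + e         ≈⟨ +-comm _ e ⟩
        e + (a + b + c + d)       ≈⟨ +-assoc e _ d ⟨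
        e + (a + b + c) + d       ≈⟨ +-congʳ (+-assoc e _ c) ⟨
        e + (a + b) + c + d       ≈⟨ +-congʳ (+-congʳ (+-assoc e a b)) ⟨
        e + a + b + c + d         ∎

    Tr∈Fq : ∀ x → InSub q (Tr q x)
    Tr∈Fq x = trans (commute-Tr frob-additive (λ _ → refl) x) (Tr-frob x)

    Tr-frob^2 : ∀ x → Tr q (frob^ 2 x) ≈ Tr q x
    Tr-frob^2 x = trans (cong Tr-additive (sym (frob²≈frob^2 x))) (trans (Tr-frob (frob x)) (Tr-frob x))

    Tr-2-torsion-Fq : ∀ {a} → InSub q a → a + a ≈ 0# → Tr q a ≈ a
    Tr-2-torsion-Fq {a} a∈Fq a+a≈0 = begin
      a + frob a + frob^ 2 a + frob^ 3 a + frob^ 4 a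
        ≈⟨ +-cong (+-cong (+-cong (+-congˡ a∈Fq) (frob^-fixes-Fq 2 a∈Fq)) (frob^-fixes-Fq 3 a∈Fq))
                  (frob^-fixes-Fq 4 a∈Fq) ⟩
      a + a + a + a + a      ≈⟨ +-congʳ (+-congʳ (+-congʳ a+a≈0)) ⟩
      0# + a + a + a         ≈⟨ +-congʳ (+-congʳ (+-identityˡ a)) ⟩
      a + a + a              ≈⟨ +-congʳ a+a≈0 ⟩
      0# + a                 ≈⟨ +-identityˡ a ⟩
      a                      ∎

  module TraceBijections (q : ℕ) {p k : ℕ} (p-prime : Prime p) (q≡p^[1+k] : q ≡ p ℕ.^ suc k)
                         (card : HasCard (q ℕ.^ 5)) where
    open FiniteField card

    private
      frob-+ : ∀ x y → pow (x + y) q ≈ pow x q + pow y q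
      frob-+ x y rewrite pow≡^ (x + y) q | pow≡^ x q | pow≡^ y q =
        ≡.subst (λ n → (x + y) ^ n ≈ x ^ n + y ^ n) (≡.sym q≡p^[1+k])
          (Frobenius.frobenius^ commutativeSemiring p-prime char-p (suc k) x y)
        where
        char-p : p · 1# ≈ 0#
        char-p = characteristic {p} {suc k ℕ.* 5}
                   (≡.trans (≡.cong (ℕ._^ 5) q≡p^[1+k]) (ℕ.^-*-assoc p (suc k) 5))

      frob^5≈id : ∀ x → pow x (q ℕ.^ 5) ≈ x
      frob^5≈id x = trans (reflexive (pow≡^ x (q ℕ.^ 5))) (fermat x)

    open Trace q frob-+ frob^5≈id

    module _ (ρ : Carrier) (Trρ≉0 : ¬ Tr q ρ ≈ 0#) (g : Carrier → Carrier) (g-additive : IsAdditive g)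
             (ker-g⊆Fq : ∀ x → g x ≈ 0# → InSub q x) (Tr∘g≈0 : ∀ x → Tr q (g x) ≈ 0#) where

      α-wellDefined : ∀ x → InSub q (Tr q (ρ * x)) × Tr q (g x) ≈ 0#
      α-wellDefined x = Tr∈Fq (ρ * x) , Tr∘g≈0 x

      α-injective : ∀ x x′ → Tr q (ρ * x) ≈ Tr q (ρ * x′) → g x ≈ g x′ → x ≈ x′
      α-injective = kernel-trivial⇒injective₂ (∘-additive Tr-additive (*-additive ρ)) g-additive kernel
        where
        kernel : ∀ z → Tr q (ρ * z) ≈ 0# → g z ≈ 0# → z ≈ 0#
        kernel z Tr[ρz]≈0 gz≈0 = *-cancelʳ-nonzero Trρ≉0 z 0# (begin
          z * Tr q ρ     ≈⟨ Tr-scalar (ker-g⊆Fq z gz≈0) ρ ⟩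
          Tr q (z * ρ)   ≈⟨ cong Tr-additive (*-comm z ρ) ⟩
          Tr q (ρ * z)   ≈⟨ Tr[ρz]≈0 ⟩
          0#             ≈⟨ zeroˡ (Tr q ρ) ⟨
          0# * Tr q ρ    ∎)

      α-surjective : ∀ θ y → InSub q θ → Tr q y ≈ 0# → ∃ λ x → Tr q (ρ * x) ≈ θ × g x ≈ y
      α-surjective θ y θ∈Fq Tr[y]≈0 = injection⇒surjection S (Tr q) ρ (Tr q ρ) (cong Tr-additive) Trρ≉0
        decodes (Tr q ∘ (ρ *_)) g α-wellDefined α-injective (θ∈Fq , Tr[y]≈0)
        where
        S : Carrier → Carrier → Set ℓ
        S θ y = InSub q θ × Tr q y ≈ 0#
        decodes : ∀ {θ y} → S θ y → Tr q (θ * ρ + y) ≈ θ * Tr q ρ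
        decodes {θ} {y} (θ∈Fq , Tr[y]≈0) = begin
          Tr q (θ * ρ + y)          ≈⟨ +-homo Tr-additive (θ * ρ) y ⟩
          Tr q (θ * ρ) + Tr q y     ≈⟨ +-cong (sym (Tr-scalar θ∈Fq ρ)) Tr[y]≈0 ⟩
          θ * Tr q ρ + 0#           ≈⟨ +-identityʳ _ ⟩
          θ * Tr q ρ                ∎

      α-bijective : (∀ x → InSub q (Tr q (ρ * x)) × Tr q (g x) ≈ 0#)
                  × (∀ x x′ → Tr q (ρ * x) ≈ Tr q (ρ * x′) → g x ≈ g x′ → x ≈ x′)
                  × (∀ θ y → InSub q θ → Tr q y ≈ 0# → ∃ λ x → Tr q (ρ * x) ≈ θ × g x ≈ y)
      α-bijective = α-wellDefined , α-injective , α-surjective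

    β : Carrier → Carrier
    β x = - x - pow x (q ℕ.^ 2)

    β-additive : IsAdditive β
    β-additive = ⊕-additive -‿additive (∘-additive -‿additive (frob^-additive 2))

    Tr∘β : ∀ x → Tr q (β x) ≈ - (Tr q x + Tr q x)
    Tr∘β x = begin
      Tr q (- x + - frob^ 2 x)          ≈⟨ +-homo Tr-additive (- x) (- frob^ 2 x) ⟩
      Tr q (- x) + Tr q (- frob^ 2 x)   ≈⟨ +-cong (-‿homo Tr-additive x) (-‿homo Tr-additive (frob^ 2 x)) ⟩
      - Tr q x + - Tr q (frob^ 2 x)     ≈⟨ +-congˡ (-‿cong (Tr-frob^2 x)) ⟩
      - Tr q x + - Tr q x               ≈⟨ -‿+-comm (Tr q x) (Tr q x) ⟩
      - (Tr q x + Tr q x)               ∎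

    β-wellDefined : ∀ x → InSub q (Tr q x) × Tr q (β x) + (Tr q x + Tr q x) ≈ 0#
    β-wellDefined x = Tr∈Fq x , trans (+-congʳ (Tr∘β x)) (-‿inverseˡ _)

    β-injective : ∀ x x′ → Tr q x ≈ Tr q x′ → β x ≈ β x′ → x ≈ x′
    β-injective = kernel-trivial⇒injective₂ Tr-additive β-additive kernel
      where
      kernel : ∀ z → Tr q z ≈ 0# → β z ≈ 0# → z ≈ 0#
      kernel z Tr[z]≈0 βz≈0 = trans (sym (Tr-2-torsion-Fq z∈Fq z+z≈0)) Tr[z]≈0
        where
        frob^2[z]≈-z : frob^ 2 z ≈ - z
        frob^2[z]≈-z = -‿injective (+-inverseʳ-unique (- z) (- frob^ 2 z) βz≈0)
        frob^4[z]≈z : frob^ 4 z ≈ z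
        frob^4[z]≈z = begin
          frob^ 4 z               ≈⟨ frob^-frob^ 2 2 z ⟨
          frob^ 2 (frob^ 2 z)     ≈⟨ cong (frob^-additive 2) frob^2[z]≈-z ⟩
          frob^ 2 (- z)           ≈⟨ -‿homo (frob^-additive 2) z ⟩
          - frob^ 2 z             ≈⟨ -‿cong frob^2[z]≈-z ⟩
          - - z                   ≈⟨ -‿involutive z ⟩
          z                       ∎
        z∈Fq : InSub q z
        z∈Fq = begin
          frob z                  ≈⟨ cong frob-additive frob^4[z]≈z ⟨
          frob (frob^ 4 z)        ≈⟨ frob^1≈frob (frob^ 4 z) ⟨
          frob^ 1 (frob^ 4 z)     ≈⟨ frob^-frob^ 1 4 z ⟩
          frob^ 5 z               ≈⟨ frob^5≈id z ⟩
          z                       ∎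
        z+z≈0 : z + z ≈ 0#
        z+z≈0 = begin
          z + z                   ≈⟨ +-congˡ (frob^-fixes-Fq 2 z∈Fq) ⟨
          z + frob^ 2 z           ≈⟨ +-congˡ frob^2[z]≈-z ⟩
          z - z                   ≈⟨ -‿inverseʳ z ⟩
          0#                      ∎

    ∃Tr≉2 : ∃ λ u → ¬ Tr q u - (1# + 1#) ≈ 0#
    ∃Tr≉2 with 1# + 1# ≟ 0#
    ... | yes 2≈0 = 1# , λ Tr[1]-2≈0 → 0≉1 (sym (begin
      1#          ≈⟨ Tr-2-torsion-Fq (pow-1# q) 2≈0 ⟨
      Tr q 1#     ≈⟨ x∙y⁻¹≈ε⇒x≈y _ _ Tr[1]-2≈0 ⟩
      1# + 1#     ≈⟨ 2≈0 ⟩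
      0#          ∎))
    ... | no 2≉0 = 0# , λ Tr[0]-2≈0 → 2≉0 (begin
      1# + 1#     ≈⟨ x∙y⁻¹≈ε⇒x≈y _ _ Tr[0]-2≈0 ⟨
      Tr q 0#     ≈⟨ 0-homo Tr-additive ⟩
      0#          ∎)

    β-surjective : ∀ θ y → InSub q θ → Tr q y + (θ + θ) ≈ 0# → ∃ λ x → Tr q x ≈ θ × β x ≈ y
    β-surjective θ y θ∈Fq Tr[y]+2θ≈0 = injection⇒surjection S (Tr q) u (Tr q u - (1# + 1#))
      (cong Tr-additive) (proj₂ ∃Tr≉2) decodes (Tr q) β β-wellDefined β-injective (θ∈Fq , Tr[y]+2θ≈0)
      where
      u : Carrier
      u = proj₁ ∃Tr≉2
      S : Carrier → Carrier → Set ℓ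
      S θ y = InSub q θ × Tr q y + (θ + θ) ≈ 0#
      decodes : ∀ {θ y} → S θ y → Tr q (θ * u + y) ≈ θ * (Tr q u - (1# + 1#))
      decodes {θ} {y} (θ∈Fq , Tr[y]+2θ≈0) = begin
        Tr q (θ * u + y)                 ≈⟨ +-homo Tr-additive (θ * u) y ⟩
        Tr q (θ * u) + Tr q y            ≈⟨ +-cong (sym (Tr-scalar θ∈Fq u)) (+-inverseˡ-unique _ _ Tr[y]+2θ≈0) ⟩
        θ * Tr q u + - (θ + θ)           ≈⟨ +-congˡ (-‿cong θ*2≈θ+θ) ⟨
        θ * Tr q u + - (θ * (1# + 1#))   ≈⟨ +-congˡ (-‿distribʳ-* θ (1# + 1#)) ⟩
        θ * Tr q u + θ * - (1# + 1#)     ≈⟨ distribˡ θ (Tr q u) (- (1# + 1#)) ⟨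
        θ * (Tr q u - (1# + 1#))         ∎
        where
        θ*2≈θ+θ : θ * (1# + 1#) ≈ θ + θ
        θ*2≈θ+θ = trans (distribˡ θ 1# 1#) (+-cong (*-identityʳ θ) (*-identityʳ θ))

    β-bijective : (∀ x → InSub q (Tr q x) × Tr q (β x) + (Tr q x + Tr q x) ≈ 0#)
                × (∀ x x′ → Tr q x ≈ Tr q x′ → β x ≈ β x′ → x ≈ x′)
                × (∀ θ y → InSub q θ → Tr q y + (θ + θ) ≈ 0# → ∃ λ x → Tr q x ≈ θ × β x ≈ y)
    β-bijective = β-wellDefined , β-injective , β-surjective

-- Imported only here: unqualified, it would clash with the ring exponentiation _^_ opened above.
open import Data.Nat using (_^_)
open import Function.Bundles using (_⇔_; Equivalence)

proposition5p2 : {c ℓ : Level} (q : ℕ) → IsPrimePower q →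
    (K : Field c ℓ) → let open Field K in let open FieldOps K in
    HasCard (q ^ 5) →
    (ρ : Carrier) → ¬ (Tr q ρ ≈ 0#) →
    (g : Carrier → Carrier) →
    (∀ x y → x ≈ y → g x ≈ g y) →
    (∀ x y → g (x + y) ≈ g x + g y) →
    (∀ a x → InSub q a → g (a * x) ≈ a * g x) →
    (∀ x → (g x ≈ 0#) ⇔ InSub q x) →
    (∀ x → Tr q (g x) ≈ 0#) →
    -- alpha : x ↦ (Tr(ρx), g x) is well defined into S and bijective onto S
    ((∀ x → InSub q (Tr q (ρ * x)) × Tr q (g x) ≈ 0#)
     × (∀ x x′ → Tr q (ρ * x) ≈ Tr q (ρ * x′) → g x ≈ g x′ → x ≈ x′)
     × (∀ θ y → InSub q θ → Tr q y ≈ 0# →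
          ∃ λ x → Tr q (ρ * x) ≈ θ × g x ≈ y))
    ×
    -- beta : x ↦ (Tr x, -x - x^{q^2}) is well defined into T and bijective onto T
    ((∀ x → InSub q (Tr q x)
              × Tr q (- x - pow x (q ^ 2)) + (Tr q x + Tr q x) ≈ 0#)
     × (∀ x x′ → Tr q x ≈ Tr q x′ → - x - pow x (q ^ 2) ≈ - x′ - pow x′ (q ^ 2) → x ≈ x′)
     × (∀ θ y → InSub q θ → Tr q y + (θ + θ) ≈ 0# →
          ∃ λ x → Tr q x ≈ θ × - x - pow x (q ^ 2) ≈ y))
proposition5p2 q (p , k , p-prime , q≡p^[1+k]) K card ρ Trρ≉0 g g-cong g-+ _ ker-g≡Fq Tr∘g≈0 =
  α-bijective ρ Trρ≉0 g (record { cong = g-cong _ _ ; +-homo = g-+ })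
    (λ x → Equivalence.to (ker-g≡Fq x)) Tr∘g≈0 , β-bijective
  where open TraceBijections K q {k = k} p-prime q≡p^[1+k] card
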